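{- Let $G$ and $H$ be finite, simple, connected graphs, each with at least two vertices, and let $S\subseteq V(G\boxtimes H)$ be a geodetic set of $G\boxtimes H$. Then either the projection $p_G(S)=\{g:(g,h)\in S\}$ is a geodetic set of $G$ or the projection $p_H(S)=\{h:(g,h)\in S\}$ is a geodetic set of $H$.
   Context: For a connected graph, $I[x,y]$ consists of $x$, $y$ and all vertices on some shortest $x$–$y$ path; $I[S]=\bigcup_{u,v\in S}I[u,v]$. $S$ is geodetic if $I[S]$ is the whole vertex set. The strong product $G\boxtimes H$ has vertex set $V(G)\times V(H)$, with $(g,h)$ and $(g',h')$ adjacent whenever ($g=g'$ and $hh'\in E(H)$), or ($h=h'$ and $gg'\in E(G)$), or ($gg'\in E(G)$ and $hh'\in E(H)$). -}

module Defs where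

open import Level using (0ℓ)
open import Data.Nat using (ℕ; zero; suc; _+_; _≤_)
open import Data.Fin using (Fin)
open import Data.Product using (Σ; ∃; _×_; _,_)
open import Data.Sum using (_⊎_)
open import Relation.Binary.PropositionalEquality using (_≡_)
open import Relation.Nullary using (¬_; Dec; yes; no)
open import Data.Bool using (Bool; true)
open import Data.Sum using (inj₁; inj₂)
open import Relation.Binary.PropositionalEquality using (refl)

record Graph (V : Set) : Set₁ where
  field
    Adj   : V → V → Set
    sym   : ∀ {x y} → Adj x y → Adj y x
    irrefl : ∀ {x} → ¬ Adj x x
    adj?  : ∀ x y → Dec (Adj x y)
open Graph public

data Walk {V : Set} (G : Graph V) : V → V → ℕ → Set where
  []  : ∀ {x} → Walk G x x zero
  _∷_ : ∀ {x y z k} → Adj G x y → Walk G y z k → Walk G x z (suc k)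

data OnWalk {V : Set} {G : Graph V} (z : V) : ∀ {x y k} → Walk G x y k → Set where
  here  : ∀ {y k} {w : Walk G z y k} → OnWalk z w
  there : ∀ {x y u k} {e : Adj G x u} {w : Walk G u y k} → OnWalk z w → OnWalk z (e ∷ w)

Connected : {V : Set} → Graph V → Set
Connected {V} G = ∀ (x y : V) → ∃ λ k → Walk G x y k

-- A walk of length k from x to y is shortest if no x–y walk is shorter.
-- (A shortest walk is automatically a path.)
Shortest : {V : Set} (G : Graph V) {x y : V} {k : ℕ} → Walk G x y k → Set
Shortest G {x} {y} {k} _ = ∀ m → Walk G x y m → k ≤ m

Interval : {V : Set} (G : Graph V) → V → V → V → Set
Interval G x y z = Σ ℕ λ k → Σ (Walk G x y k) λ w → Shortest G w × OnWalk z w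

Geodetic : {V : Set} (G : Graph V) → (V → Set) → Set
Geodetic {V} G S = ∀ (z : V) → Σ V λ x → Σ V λ y → S x × S y × Interval G x y z

-- Strong product.
-- (vertex types need decidable equality for the product adjacency to be decidable)
data StrongAdj {A B : Set} (G : Graph A) (H : Graph B) : A × B → A × B → Set where
  sameG : ∀ {g h h'} → Adj H h h' → StrongAdj G H (g , h) (g , h')
  sameH : ∀ {g g' h} → Adj G g g' → StrongAdj G H (g , h) (g' , h)
  both  : ∀ {g g' h h'} → Adj G g g' → Adj H h h' → StrongAdj G H (g , h) (g' , h')

strong : {A B : Set} → (∀ (a a' : A) → Dec (a ≡ a')) → (∀ (b b' : B) → Dec (b ≡ b'))
       → Graph A → Graph B → Graph (A × B)
strong {A} {B} _≟A_ _≟B_ G H = record { Adj = StrongAdj G H ; sym = s ; irrefl = i ; adj? = d }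
  where
  s : ∀ {x y} → StrongAdj G H x y → StrongAdj G H y x
  s (sameG a) = sameG (sym H a)
  s (sameH a) = sameH (sym G a)
  s (both a b) = both (sym G a) (sym H b)
  i : ∀ {x} → ¬ StrongAdj G H x x
  i (sameG a) = irrefl H a
  i (sameH a) = irrefl G a
  i (both a b) = irrefl G a
  d : ∀ x y → Dec (StrongAdj G H x y)
  d (g , h) (g' , h') with adj? G g g' | adj? H h h'
  ... | yes a | yes b = yes (both a b)
  ... | yes a | no ¬b with h ≟B h'
  ...   | yes refl = yes (sameH a)
  ...   | no h≢ = no λ { (sameG x) → ¬b x ; (sameH x) → h≢ refl ; (both x y) → ¬b y }
  d (g , h) (g' , h') | no ¬a | yes b with g ≟A g'
  ...   | yes refl = yes (sameG b)
  ...   | no g≢ = no λ { (sameG x) → g≢ refl ; (sameH x) → ¬a x ; (both x y) → ¬a x }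
  d (g , h) (g' , h') | no ¬a | no ¬b = no λ { (sameG x) → ¬b x ; (sameH x) → ¬a x ; (both x y) → ¬a x }

_∈ˢ_ : {V : Set} → V → (V → Bool) → Set
v ∈ˢ S = S v ≡ true

projG : {A B : Set} → (A × B → Set) → A → Set
projG {A} {B} S g = Σ B λ h → S (g , h)

projH : {A B : Set} → (A × B → Set) → B → Set
projH {A} {B} S h = Σ A λ g → S (g , h)

_ᵖ : {V : Set} → (V → Bool) → V → Set
(S ᵖ) v = v ∈ˢ S

module Submission where

-- In the strong product G ⊠ H a walk projects onto a
-- walk of G and a walk of H (a step that stays in one coordinate is
-- dropped from that coordinate's projection), and conversely a G-walk of
-- length i and an H-walk of length j zip into a product walk of length
-- i ⊔ j.  Hence for a shortest product walk w of length D either no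
-- G-walk between its end coordinates is shorter than D, so the
-- G-projection of w is shortest, or some G-walk is, and then no H-walk
-- can be shorter than D either (zipping the two would beat w), so the
-- H-projection of w is shortest.  Consequently every vertex (g , h)
-- that a geodetic set S covers in G ⊠ H yields a cover of g by p_G(S) in
-- G or a cover of h by p_H(S) in H.  A purely logical fact about finite
-- index sets, (∀ g h → P g ⊎ Q h) → (∀ g → P g) ⊎ (∀ h → Q h), turns this
-- pointwise alternative into the global one.

open import Defs
open import Data.Nat using (ℕ; _≤_)
open import Data.Fin using (Fin; _≟_)
open import Data.Bool using (Bool)
open import Data.Product using (_×_)
open import Data.Sum using (_⊎_)

open import Data.Nat using (zero; suc; _⊔_; s≤s; z≤n)
open import Data.Nat.Properties
  using (≤-trans; ≮⇒≥; <⇒≱; ⊔-lub; n≤1+n; anyUpTo?)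
open import Data.Fin using (zero; suc)
open import Data.Fin.Properties using (any?)
open import Data.Product using (Σ; _,_; proj₁; proj₂)
open import Data.Sum using (inj₁; inj₂; swap)
open import Relation.Nullary using (Dec; yes; no)
open import Relation.Nullary.Decidable using (_×-dec_)
open import Relation.Binary.Definitions using (DecidableEquality)
open import Relation.Binary.PropositionalEquality using (_≡_; refl)

finite-choice : ∀ n {A : Set} {Q : Fin n → Set}
              → (∀ i → A ⊎ Q i) → A ⊎ (∀ i → Q i)
finite-choice zero    f = inj₂ λ ()
finite-choice (suc n) f with f zero | finite-choice n (λ i → f (suc i))
... | inj₁ a | _       = inj₁ a
... | inj₂ q | inj₁ a  = inj₁ a
... | inj₂ q | inj₂ qs = inj₂ λ { zero → q ; (suc i) → qs i }

grid-choice : ∀ m n {P : Fin m → Set} {Q : Fin n → Set}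
            → (∀ g h → P g ⊎ Q h) → (∀ g → P g) ⊎ (∀ h → Q h)
grid-choice m n f =
  swap (finite-choice m (λ g → swap (finite-choice n (f g))))

walk? : ∀ {m} (G : Graph (Fin m)) k x y → Dec (Walk G x y k)
walk? G zero x y with x ≟ y
... | yes refl = yes []
... | no x≢y   = no λ { [] → x≢y refl }
walk? G (suc k) x y with any? (λ u → adj? G x u ×-dec walk? G k u y)
... | yes (u , e , w) = yes (e ∷ w)
... | no ¬step        = no λ { (_∷_ {y = u} e w) → ¬step (u , e , w) }

Covers : {V : Set} (G : Graph V) → (V → Set) → V → Set
Covers {V} G S z = Σ V λ x → Σ V λ y → S x × S y × Interval G x y z

module StrongProduct {A B : Set} (_≟A_ : DecidableEquality A)
                     (_≟B_ : DecidableEquality B)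
                     (G : Graph A) (H : Graph B) where

  G⊠H : Graph (A × B)
  G⊠H = strong _≟A_ _≟B_ G H

  lengthG : ∀ {x y k} → Walk G⊠H x y k → ℕ
  lengthG []               = zero
  lengthG (sameG _   ∷ w)  = lengthG w
  lengthG (sameH _   ∷ w)  = suc (lengthG w)
  lengthG (both _ _  ∷ w)  = suc (lengthG w)

  projectG : ∀ {x y k} (w : Walk G⊠H x y k)
           → Walk G (proj₁ x) (proj₁ y) (lengthG w)
  projectG []              = []
  projectG (sameG _  ∷ w)  = projectG w
  projectG (sameH e  ∷ w)  = e ∷ projectG w
  projectG (both e _ ∷ w)  = e ∷ projectG w

  lengthG≤ : ∀ {x y k} (w : Walk G⊠H x y k) → lengthG w ≤ k
  lengthG≤ []              = z≤n
  lengthG≤ (sameG _  ∷ w)  = ≤-trans (lengthG≤ w) (n≤1+n _)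
  lengthG≤ (sameH _  ∷ w)  = s≤s (lengthG≤ w)
  lengthG≤ (both _ _ ∷ w)  = s≤s (lengthG≤ w)

  onProjectG : ∀ {z x y k} (w : Walk G⊠H x y k)
             → OnWalk z w → OnWalk (proj₁ z) (projectG w)
  onProjectG w              here      = here
  onProjectG (sameG _  ∷ w) (there o) = onProjectG w o
  onProjectG (sameH _  ∷ w) (there o) = there (onProjectG w o)
  onProjectG (both _ _ ∷ w) (there o) = there (onProjectG w o)

  lengthH : ∀ {x y k} → Walk G⊠H x y k → ℕ
  lengthH []               = zero
  lengthH (sameG _   ∷ w)  = suc (lengthH w)
  lengthH (sameH _   ∷ w)  = lengthH w
  lengthH (both _ _  ∷ w)  = suc (lengthH w)

  projectH : ∀ {x y k} (w : Walk G⊠H x y k)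
           → Walk H (proj₂ x) (proj₂ y) (lengthH w)
  projectH []              = []
  projectH (sameG f  ∷ w)  = f ∷ projectH w
  projectH (sameH _  ∷ w)  = projectH w
  projectH (both _ f ∷ w)  = f ∷ projectH w

  lengthH≤ : ∀ {x y k} (w : Walk G⊠H x y k) → lengthH w ≤ k
  lengthH≤ []              = z≤n
  lengthH≤ (sameG _  ∷ w)  = s≤s (lengthH≤ w)
  lengthH≤ (sameH _  ∷ w)  = ≤-trans (lengthH≤ w) (n≤1+n _)
  lengthH≤ (both _ _ ∷ w)  = s≤s (lengthH≤ w)

  onProjectH : ∀ {z x y k} (w : Walk G⊠H x y k)
             → OnWalk z w → OnWalk (proj₂ z) (projectH w)
  onProjectH w              here      = here
  onProjectH (sameG _  ∷ w) (there o) = there (onProjectH w o)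
  onProjectH (sameH _  ∷ w) (there o) = onProjectH w o
  onProjectH (both _ _ ∷ w) (there o) = there (onProjectH w o)

  zipWalks : ∀ {a b c d i j} → Walk G a b i → Walk H c d j
           → Walk G⊠H (a , c) (b , d) (i ⊔ j)
  zipWalks []      []      = []
  zipWalks []      (f ∷ v) = sameG f ∷ zipWalks [] v
  zipWalks (e ∷ u) []      = sameH e ∷ liftG u
    where
    liftG : ∀ {a b c i} → Walk G a b i → Walk G⊠H (a , c) (b , c) i
    liftG []      = []
    liftG (e ∷ u) = sameH e ∷ liftG u
  zipWalks (e ∷ u) (f ∷ v) = both e f ∷ zipWalks u v

  -- The case split is whether G has a walk shorter than w between the
  -- first coordinates, which is decidable when walks of G are.
  shortest-projects : (∀ k a b → Dec (Walk G a b k))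
                    → ∀ {x y D} (w : Walk G⊠H x y D) → Shortest G⊠H w
                    → Shortest G (projectG w) ⊎ Shortest H (projectH w)
  shortest-projects walkG? {x} {y} {D} w w-shortest
    with anyUpTo? (λ k → walkG? k (proj₁ x) (proj₁ y)) D
  ... | no ¬shorterG = inj₁ λ k u →
          ≤-trans (lengthG≤ w) (≮⇒≥ λ k<D → ¬shorterG (k , k<D , u))
  ... | yes (i , i<D , u) = inj₂ λ k v →
          ≤-trans (lengthH≤ w) (≮⇒≥ λ k<D →
            <⇒≱ (⊔-lub i<D k<D) (w-shortest _ (zipWalks u v)))

  interval-projects : (∀ k a b → Dec (Walk G a b k))
                    → ∀ {x y z} → Interval G⊠H x y z
                    → Interval G (proj₁ x) (proj₁ y) (proj₁ z)
                      ⊎ Interval H (proj₂ x) (proj₂ y) (proj₂ z)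
  interval-projects walkG? (_ , w , w-shortest , z∈w)
    with shortest-projects walkG? w w-shortest
  ... | inj₁ sG = inj₁ (_ , projectG w , sG , onProjectG w z∈w)
  ... | inj₂ sH = inj₂ (_ , projectH w , sH , onProjectH w z∈w)

  covers-projects : (∀ k a b → Dec (Walk G a b k))
                  → (S : A × B → Set) → ∀ {g h}
                  → Covers G⊠H S (g , h)
                  → Covers G (projG S) g ⊎ Covers H (projH S) h
  covers-projects walkG? S ((a , c) , (b , d) , Sx , Sy , I)
    with interval-projects walkG? I
  ... | inj₁ IG = inj₁ (a , b , (c , Sx) , (d , Sy) , IG)
  ... | inj₂ IH = inj₂ (c , d , (a , Sx) , (b , Sy) , IH)

-- The theorem: the pointwise alternative of covers-projects is made
-- global by grid-choice.
proposition2 : (m n : ℕ) → 2 ≤ m → 2 ≤ n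
    → (G : Graph (Fin m)) → (H : Graph (Fin n))
    → Connected G → Connected H
    → (S : Fin m × Fin n → Bool)
    → Geodetic (strong _≟_ _≟_ G H) (S ᵖ)
    → Geodetic G (projG (S ᵖ)) ⊎ Geodetic H (projH (S ᵖ))
proposition2 m n _ _ G H _ _ S geodetic =
  grid-choice m n λ g h →
    covers-projects (walk? G) (S ᵖ) (geodetic (g , h))
  where open StrongProduct _≟_ _≟_ G H
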